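{- Let $d$ be a positive integer and let $\mathcal H$ be a $d$-regular $(r,t)$-graph. Then \[ \tau(\mathcal H)\le \frac rt-\frac{r}{dt}+\frac1d, \] with equality if and only if $\mathcal H$ is (isomorphic to) the dual of a resolvable $2$-$(v,d,t)$ design for some $v$.
   Context: All hypergraphs are finite. An $r$-uniform hypergraph $\mathcal H$ is $r$-partite if its vertex set can be partitioned as $V(\mathcal H)=P_1\sqcup\dots\sqcup P_r$ such that $|e\cap P_j|=1$ for every edge $e$ and every $j\in[r]$. It is $t$-intersecting if $|e\cap f|\ge t$ for all $e,f\in E(\mathcal H)$. An $(r,t)$-graph is an $r$-uniform, $r$-partite, $t$-intersecting hypergraph. $\mathcal H$ is $d$-regular if every vertex lies in exactly $d$ edges. A cover of $\mathcal H$ is a set $C\subseteq V(\mathcal H)$ with $C\cap e\neq\emptyset$ for every edge $e$; $\tau(\mathcal H)$ is the minimum size of a cover. A $2$-$(v,d,t)$ design is a $d$-uniform hypergraph on $v$ vertices in which any two distinct vertices lie in exactly $t$ common edges; it is resolvable if its edge set can be partitioned into perfect matchings. The dual $\mathcal H^D$ of a hypergraph $\mathcal H$ has vertex set $E(\mathcal H)$ and edge set $\{\{e\in E(\mathcal H): u\in e\}: u\in V(\mathcal H)\}$. -}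

module Defs where

open import Data.Nat using (ℕ; _≤_; _+_; _*_)
open import Data.Bool using (Bool; _∧_)
open import Data.Fin using (Fin)
open import Data.Fin.Subset using (Subset; _∈_; _∩_; ∣_∣; Nonempty)
open import Data.Vec using (tabulate; lookup)
open import Data.Product using (Σ; _×_; ∃)
open import Relation.Binary.PropositionalEquality using (_≡_; _≢_)
open import Function.Bundles using (_↔_; Inverse)

-- A finite hypergraph: vertex set Fin nV, edges an indexed family
-- (Fin nE) of subsets of the vertex set (repeated edges allowed).
record Hypergraph : Set where
  constructor mkHG
  field
    nV   : ℕ
    nE   : ℕ
    edge : Fin nE → Subset nV
open Hypergraph public

edgesAt : (H : Hypergraph) → Fin (nV H) → Subset (nE H)
edgesAt H x = tabulate (λ e → lookup (edge H e) x)

edgesAt₂ : (H : Hypergraph) → Fin (nV H) → Fin (nV H) → Subset (nE H)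
edgesAt₂ H x y = tabulate (λ e → lookup (edge H e) x ∧ lookup (edge H e) y)

Uniform : ℕ → Hypergraph → Set
Uniform r H = ∀ e → ∣ edge H e ∣ ≡ r

-- vertex partition into r (possibly empty) parts P_1..P_r given by a map
-- part : V → Fin r, such that every edge meets each part in exactly one vertex
Partite : ℕ → Hypergraph → Set
Partite r H =
  Σ (Fin (nV H) → Fin r) λ part →
    ∀ (e : Fin (nE H)) (j : Fin r) →
      Σ (Fin (nV H)) λ x → (x ∈ edge H e) × (part x ≡ j) ×
        (∀ y → y ∈ edge H e → part y ≡ j → y ≡ x)

Intersecting : ℕ → Hypergraph → Set
Intersecting t H = ∀ e f → t ≤ ∣ edge H e ∩ edge H f ∣

RTGraph : ℕ → ℕ → Hypergraph → Set
RTGraph r t H = Uniform r H × Partite r H × Intersecting t H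

Regular : ℕ → Hypergraph → Set
Regular d H = ∀ x → ∣ edgesAt H x ∣ ≡ d

IsCover : (H : Hypergraph) → Subset (nV H) → Set
IsCover H C = ∀ e → Nonempty (C ∩ edge H e)

IsTau : Hypergraph → ℕ → Set
IsTau H k = (Σ (Subset (nV H)) λ C → IsCover H C × ∣ C ∣ ≡ k)
          × (∀ C → IsCover H C → k ≤ ∣ C ∣)

Design : ℕ → ℕ → ℕ → Hypergraph → Set
Design v d t D = (nV D ≡ v) × Uniform d D
               × (∀ x y → x ≢ y → ∣ edgesAt₂ D x y ∣ ≡ t)

Resolvable : Hypergraph → Set
Resolvable D =
  Σ ℕ λ k → Σ (Fin (nE D) → Fin k) λ cls →
    ∀ (c : Fin k) (x : Fin (nV D)) →
      Σ (Fin (nE D)) λ e → (cls e ≡ c) × (x ∈ edge D e) ×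
        (∀ f → cls f ≡ c → x ∈ edge D f → f ≡ e)

Dual : Hypergraph → Hypergraph
Dual H = mkHG (nE H) (nV H) (edgesAt H)

Isomorphic : Hypergraph → Hypergraph → Set
Isomorphic H K =
  Σ (Fin (nV H) ↔ Fin (nV K)) λ σ → Σ (Fin (nE H) ↔ Fin (nE K)) λ π →
    ∀ e x → lookup (edge H e) x ≡ lookup (edge K (Inverse.to π e)) (Inverse.to σ x)

module Submission where

-- The proof combines two double counts:
--   * covers: the r parts of H are covers partitioning V, so r·τ ≤ |V|, and
--     |V|·d = m·r gives d·τ ≤ m; conversely a cover meets all m edges and
--     each vertex lies in d of them, so m ≤ d·τ.
--   * intersection rows: for an edge e, Σ_f |e ∩ f| = r·d; the term f = e
--     is r and the other m - 1 terms are ≥ t, so m·t + r ≤ r·d + t, with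
--     equality iff |e ∩ f| = t for all f ≠ e.
-- So d·t·τ + r ≤ m·t + r ≤ r·d + t.  Equality makes all pairwise
-- intersections t, i.e. Dual H is a 2-(m,d,t) design, resolvable with the
-- parts of H as parallel classes, and H ≅ Dual (Dual H).  Conversely the
-- dual of a design has all intersections t, so both estimates are tight.

open import Defs
open import Data.Nat using (ℕ; _≤_; _+_; _*_)
open import Data.Product using (Σ; _×_)
open import Relation.Binary.PropositionalEquality using (_≡_)
open import Function.Bundles using (_⇔_)

open import Data.Nat using (zero; suc; NonZero; >-nonZero; z≤n; s≤s)
open import Data.Nat.Properties
open import Data.Nat.Solver using (module +-*-Solver)
open import Data.Bool using (Bool; true; false; _∧_)
open import Data.Fin using (Fin; zero; suc; punchIn; punchOut; fromℕ<)
open import Data.Fin.Properties using (punchInᵢ≢i; punchIn-punchOut)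
open import Data.Fin.Subset using (Subset; _∈_; _∩_; ∣_∣; ⁅_⁆; Nonempty)
open import Data.Fin.Subset.Properties using (x∈⁅x⁆; ∣⁅x⁆∣≡1; ∩-idem; x∈p∩q⁺; x∈p⇒∣p-x∣<∣p∣)
open import Data.Vec using ([]; _∷_; lookup; tabulate)
open import Data.Vec.Properties
  using (lookup∘tabulate; lookup-zipWith; tabulate∘lookup; tabulate-cong; []=⇒lookup; lookup⇒[]=)
open import Data.Product using (_,_)
open import Function.Base using (_∘_)
open import Function.Bundles using (_↔_; mk⇔; Inverse; Injection)
open import Function.Construct.Identity using (↔-id)
open import Function.Properties.Inverse using (Inverse⇒Injection)
open import Relation.Binary.PropositionalEquality
  using (refl; sym; trans; cong; cong₂; subst; subst₂; _≢_; module ≡-Reasoning)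
open import Algebra.Properties.Semiring.Sum +-*-semiring
  using (sum; sum-cong-≗; sum-remove; ∑-comm; ∑-permute; *-distribˡ-sum; *-distribʳ-sum)

sum-mono-≤ : ∀ {n} {f g : Fin n → ℕ} → (∀ i → f i ≤ g i) → sum f ≤ sum g
sum-mono-≤ {zero}  f≤g = z≤n
sum-mono-≤ {suc n} f≤g = +-mono-≤ (f≤g zero) (sum-mono-≤ (f≤g ∘ suc))

sum-const : ∀ n c → sum {n} (λ _ → c) ≡ n * c
sum-const zero    c = refl
sum-const (suc n) c = cong (c +_) (sum-const n c)

sum-tight : ∀ {n} c (f : Fin n → ℕ) → (∀ i → c ≤ f i) → sum f ≤ n * c → ∀ i → f i ≡ c
sum-tight {suc n} c f c≤f upper i = ≤-antisym (+-cancelʳ-≤ (n * c) (f i) c fi+rest≤) (c≤f i)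
  where
  open ≤-Reasoning
  fi+rest≤ : f i + n * c ≤ c + n * c
  fi+rest≤ = begin
    f i + n * c                 ≤⟨ +-monoʳ-≤ (f i) (subst (_≤ _) (sum-const n c) (sum-mono-≤ (c≤f ∘ punchIn i))) ⟩
    f i + sum (f ∘ punchIn i)   ≡⟨ sum-remove f ⟨
    sum f                       ≤⟨ upper ⟩
    c + n * c                   ∎

-- Pulling the i-th term out of a sum; the extra t matches the shape
-- n·t = t + (n - 1)·t of the comparisons below.
sum-split : ∀ {n} t (i : Fin (suc n)) (h : Fin (suc n) → ℕ) →
            sum h + t ≡ (t + sum (h ∘ punchIn i)) + h i
sum-split t i h = trans (cong (_+ t) (sum-remove h)) (solve 3 (λ a b c → (a :+ b) :+ c := (c :+ b) :+ a) refl (h i) _ t)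
  where open +-*-Solver

punchIn-≢ : ∀ {n} (i : Fin (suc n)) j → i ≢ punchIn i j
punchIn-≢ i j i≡ = punchInᵢ≢i i j (sym i≡)

module _ (t : ℕ) where

  sum-except-≥ : ∀ {n} (i : Fin n) (h : Fin n → ℕ) → (∀ j → i ≢ j → t ≤ h j) →
                 n * t + h i ≤ sum h + t
  sum-except-≥ {suc n} i h t≤h = ≤-trans (+-monoˡ-≤ (h i) (+-monoʳ-≤ t rest≥)) (≤-reflexive (sym (sum-split t i h)))
    where
    rest≥ : n * t ≤ sum (h ∘ punchIn i)
    rest≥ = subst (_≤ _) (sum-const n t) (sum-mono-≤ (λ j → t≤h (punchIn i j) (punchIn-≢ i j)))

  sum-except-tight : ∀ {n} (i : Fin n) (h : Fin n → ℕ) → (∀ j → i ≢ j → t ≤ h j) →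
                     sum h + t ≤ n * t + h i → ∀ j → i ≢ j → h j ≡ t
  sum-except-tight {suc n} i h t≤h upper j i≢j =
    subst (_≡ t) (cong h (punchIn-punchOut i≢j)) (sum-tight t (h ∘ punchIn i) others≥ rest≤ (punchOut i≢j))
    where
    others≥ : ∀ k → t ≤ h (punchIn i k)
    others≥ k = t≤h (punchIn i k) (punchIn-≢ i k)
    rest≤ : sum (h ∘ punchIn i) ≤ n * t
    rest≤ = +-cancelˡ-≤ t _ _ (+-cancelʳ-≤ (h i) _ _ (≤-trans (≤-reflexive (sym (sum-split t i h))) upper))

  sum-except-exact : ∀ {n} (i : Fin n) (h : Fin n → ℕ) → (∀ j → i ≢ j → h j ≡ t) →
                     sum h + t ≡ n * t + h i
  sum-except-exact {suc n} i h h≡t = trans (sum-split t i h) (cong (λ s → (t + s) + h i) rest≡)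
    where
    rest≡ : sum (h ∘ punchIn i) ≡ n * t
    rest≡ = trans (sum-cong-≗ (λ k → h≡t (punchIn i k) (punchIn-≢ i k))) (sum-const n t)

ι : Bool → ℕ
ι true  = 1
ι false = 0

ι-∧ : ∀ a b → ι (a ∧ b) ≡ ι a * ι b
ι-∧ true  b = sym (+-identityʳ (ι b))
ι-∧ false b = refl

∣∣-as-sum : ∀ {n} (s : Subset n) → ∣ s ∣ ≡ sum (λ i → ι (lookup s i))
∣∣-as-sum []          = refl
∣∣-as-sum (true ∷ s)  = cong suc (∣∣-as-sum s)
∣∣-as-sum (false ∷ s) = ∣∣-as-sum s

∣∩∣-as-sum : ∀ {n} (s s′ : Subset n) → ∣ s ∩ s′ ∣ ≡ sum (λ i → ι (lookup s i) * ι (lookup s′ i))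
∣∩∣-as-sum s s′ = trans (∣∣-as-sum (s ∩ s′))
  (sum-cong-≗ (λ i → trans (cong ι (lookup-zipWith _∧_ i s s′)) (ι-∧ (lookup s i) (lookup s′ i))))

∣∣-reindex : ∀ {m n} (σ : Fin m ↔ Fin n) (s : Subset m) (s′ : Subset n) →
             (∀ i → lookup s i ≡ lookup s′ (Inverse.to σ i)) → ∣ s ∣ ≡ ∣ s′ ∣
∣∣-reindex σ s s′ s≡s′∘σ = begin
  ∣ s ∣                                          ≡⟨ ∣∣-as-sum s ⟩
  sum (λ i → ι (lookup s i))                     ≡⟨ sum-cong-≗ (cong ι ∘ s≡s′∘σ) ⟩
  sum (λ i → ι (lookup s′ (Inverse.to σ i)))     ≡⟨ ∑-permute (λ j → ι (lookup s′ j)) σ ⟨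
  sum (λ j → ι (lookup s′ j))                    ≡⟨ ∣∣-as-sum s′ ⟨
  ∣ s′ ∣                                         ∎
  where open ≡-Reasoning

nonempty⇒1≤∣∣ : ∀ {n} (s : Subset n) → Nonempty s → 1 ≤ ∣ s ∣
nonempty⇒1≤∣∣ s (x , x∈s) = ≤-trans (s≤s z≤n) (x∈p⇒∣p-x∣<∣p∣ x∈s)

inc : (H : Hypergraph) → Fin (nE H) → Fin (nV H) → ℕ
inc H e x = ι (lookup (edge H e) x)

degree-as-sum : (H : Hypergraph) (x : Fin (nV H)) → ∣ edgesAt H x ∣ ≡ sum (λ e → inc H e x)
degree-as-sum H x = trans (∣∣-as-sum (edgesAt H x))
  (sum-cong-≗ (λ e → cong ι (lookup∘tabulate (λ e → lookup (edge H e) x) e)))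

weighted-double-count : ∀ {d} (H : Hypergraph) → Regular d H → (w : Fin (nV H) → ℕ) →
                        sum (λ e → sum (λ x → w x * inc H e x)) ≡ sum w * d
weighted-double-count {d} H reg w = begin
  sum (λ e → sum (λ x → w x * inc H e x))   ≡⟨ ∑-comm (λ e x → w x * inc H e x) ⟩
  sum (λ x → sum (λ e → w x * inc H e x))   ≡⟨ sum-cong-≗ (λ x → *-distribˡ-sum (w x) (λ e → inc H e x)) ⟨
  sum (λ x → w x * sum (λ e → inc H e x))   ≡⟨ sum-cong-≗ (λ x → cong (w x *_) (trans (sym (degree-as-sum H x)) (reg x))) ⟩
  sum (λ x → w x * d)                       ≡⟨ *-distribʳ-sum d w ⟨
  sum w * d                                 ∎
  where open ≡-Reasoning

handshake : ∀ {r d} (H : Hypergraph) → Uniform r H → Regular d H → nE H * r ≡ nV H * d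
handshake {r} {d} H uni reg = begin
  nE H * r                                  ≡⟨ sum-const (nE H) r ⟨
  sum (λ (e : Fin (nE H)) → r)              ≡⟨ sum-cong-≗ (λ e → trans (sym (uni e)) (∣∣-as-sum (edge H e))) ⟩
  sum (λ e → sum (λ x → inc H e x))         ≡⟨ sum-cong-≗ (λ e → sum-cong-≗ (λ x → *-identityˡ (inc H e x))) ⟨
  sum (λ e → sum (λ x → 1 * inc H e x))     ≡⟨ weighted-double-count H reg (λ _ → 1) ⟩
  sum (λ (x : Fin (nV H)) → 1) * d          ≡⟨ cong (_* d) (trans (sum-const (nV H) 1) (*-identityʳ (nV H))) ⟩
  nV H * d                                  ∎
  where open ≡-Reasoning

meet : (H : Hypergraph) → Fin (nE H) → Fin (nE H) → ℕ
meet H e f = ∣ edge H e ∩ edge H f ∣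

meet-diagonal : ∀ {r} (H : Hypergraph) → Uniform r H → ∀ e → meet H e e ≡ r
meet-diagonal H uni e = trans (cong ∣_∣ (∩-idem (edge H e))) (uni e)

-- Each row of the intersection matrix sums to r·d: each of the r vertices
-- of e lies in d edges.
meet-row-sum : ∀ {r d} (H : Hypergraph) → Uniform r H → Regular d H →
               ∀ e → sum (meet H e) ≡ r * d
meet-row-sum {r} {d} H uni reg e = begin
  sum (meet H e)                                  ≡⟨ sum-cong-≗ (λ f → ∣∩∣-as-sum (edge H e) (edge H f)) ⟩
  sum (λ f → sum (λ x → inc H e x * inc H f x))   ≡⟨ weighted-double-count H reg (inc H e) ⟩
  sum (inc H e) * d                               ≡⟨ cong (_* d) (trans (sym (∣∣-as-sum (edge H e))) (uni e)) ⟩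
  r * d                                           ∎
  where open ≡-Reasoning

Pairwise : ℕ → Hypergraph → Set
Pairwise t H = ∀ e f → e ≢ f → meet H e f ≡ t

module _ {r d t : ℕ} (H : Hypergraph) (uni : Uniform r H) (reg : Regular d H) where

  row-bound : Intersecting t H → Fin (nE H) → nE H * t + r ≤ r * d + t
  row-bound int e = subst₂ _≤_ (cong (nE H * t +_) (meet-diagonal H uni e)) (cong (_+ t) (meet-row-sum H uni reg e))
                      (sum-except-≥ t e (meet H e) (λ f _ → int e f))

  row-tight : Intersecting t H → r * d + t ≤ nE H * t + r → Pairwise t H
  row-tight int upper e =
    sum-except-tight t e (meet H e) (λ f _ → int e f)
      (subst₂ _≤_ (cong (_+ t) (sym (meet-row-sum H uni reg e))) (cong (nE H * t +_) (sym (meet-diagonal H uni e))) upper)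

  row-exact : Pairwise t H → Fin (nE H) → r * d + t ≡ nE H * t + r
  row-exact pw e = subst₂ _≡_ (cong (_+ t) (meet-row-sum H uni reg e)) (cong (nE H * t +_) (meet-diagonal H uni e))
                     (sum-except-exact t e (meet H e) (pw e))

cover-lower-bound : ∀ {d} (H : Hypergraph) → Regular d H → ∀ C → IsCover H C → nE H ≤ ∣ C ∣ * d
cover-lower-bound {d} H reg C cov = begin
  nE H                                           ≡⟨ trans (sum-const (nE H) 1) (*-identityʳ (nE H)) ⟨
  sum (λ (e : Fin (nE H)) → 1)                   ≤⟨ sum-mono-≤ (λ e → nonempty⇒1≤∣∣ (C ∩ edge H e) (cov e)) ⟩
  sum (λ e → ∣ C ∩ edge H e ∣)                   ≡⟨ sum-cong-≗ (λ e → ∣∩∣-as-sum C (edge H e)) ⟩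
  sum (λ e → sum (λ x → ι (lookup C x) * inc H e x)) ≡⟨ weighted-double-count H reg (λ x → ι (lookup C x)) ⟩
  sum (λ x → ι (lookup C x)) * d                 ≡⟨ cong (_* d) (∣∣-as-sum C) ⟨
  ∣ C ∣ * d                                      ∎
  where open ≤-Reasoning

fibre : ∀ {n r} → (Fin n → Fin r) → Fin r → Subset n
fibre part j = tabulate (λ x → lookup ⁅ part x ⁆ j)

∈-own-fibre : ∀ {n r} (part : Fin n → Fin r) x → x ∈ fibre part (part x)
∈-own-fibre part x = lookup⇒[]= x (fibre part (part x))
  (trans (lookup∘tabulate (λ y → lookup ⁅ part y ⁆ (part x)) x) ([]=⇒lookup (x∈⁅x⁆ (part x))))

fibres-partition : ∀ {n r} (part : Fin n → Fin r) → sum (λ j → ∣ fibre part j ∣) ≡ n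
fibres-partition {n} part = begin
  sum (λ j → ∣ fibre part j ∣)                         ≡⟨ sum-cong-≗ (λ j → ∣∣-as-sum (fibre part j)) ⟩
  sum (λ j → sum (λ x → ι (lookup (fibre part j) x)))  ≡⟨ ∑-comm (λ j x → ι (lookup (fibre part j) x)) ⟩
  sum (λ x → sum (λ j → ι (lookup (fibre part j) x)))  ≡⟨ sum-cong-≗ (λ x → sum-cong-≗ (λ j →
                                                           cong ι (lookup∘tabulate (λ y → lookup ⁅ part y ⁆ j) x))) ⟩
  sum (λ x → sum (λ j → ι (lookup ⁅ part x ⁆ j)))      ≡⟨ sum-cong-≗ (λ x → trans (sym (∣∣-as-sum ⁅ part x ⁆)) (∣⁅x⁆∣≡1 (part x))) ⟩
  sum (λ (x : Fin n) → 1)                             ≡⟨ trans (sum-const n 1) (*-identityʳ n) ⟩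
  n                                                   ∎
  where open ≡-Reasoning

-- In an r-partite hypergraph the r parts are covers partitioning the
-- vertex set, so r·k ≤ |V| whenever every cover has at least k vertices.
partite-cover-bound : ∀ {r} (H : Hypergraph) → Partite r H →
                      ∀ k → (∀ C → IsCover H C → k ≤ ∣ C ∣) → r * k ≤ nV H
partite-cover-bound {r} H (part , meets) k minimal = begin
  r * k                              ≡⟨ sum-const r k ⟨
  sum (λ (_ : Fin r) → k)            ≤⟨ sum-mono-≤ (λ j → minimal (fibre part j) (part-covers j)) ⟩
  sum (λ j → ∣ fibre part j ∣)       ≡⟨ fibres-partition part ⟩
  nV H                               ∎
  where
  open ≤-Reasoning
  part-covers : ∀ j → IsCover H (fibre part j)
  part-covers j e with meets e j
  ... | x , x∈e , refl , _ = x , x∈p∩q⁺ (∈-own-fibre part x , x∈e)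

regular-partite-cover-bound : ∀ {r d} (H : Hypergraph) → .{{NonZero r}} →
  Uniform r H → Partite r H → Regular d H → ∀ k → (∀ C → IsCover H C → k ≤ ∣ C ∣) → d * k ≤ nE H
regular-partite-cover-bound {r} {d} H uni partite reg k minimal = *-cancelˡ-≤ r (begin
  r * (d * k)   ≡⟨ solve 3 (λ r d k → r :* (d :* k) := d :* (r :* k)) refl r d k ⟩
  d * (r * k)   ≤⟨ *-monoʳ-≤ d (partite-cover-bound H partite k minimal) ⟩
  d * nV H      ≡⟨ trans (*-comm d (nV H)) (sym (handshake H uni reg)) ⟩
  nE H * r      ≡⟨ *-comm (nE H) r ⟩
  r * nE H      ∎)
  where
  open ≤-Reasoning
  open +-*-Solver

∈-edgesAt⁺ : (H : Hypergraph) {e : Fin (nE H)} {x : Fin (nV H)} → x ∈ edge H e → e ∈ edgesAt H x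
∈-edgesAt⁺ H {e} {x} x∈e = lookup⇒[]= e (edgesAt H x)
  (trans (lookup∘tabulate (λ e → lookup (edge H e) x) e) ([]=⇒lookup x∈e))

∈-edgesAt⁻ : (H : Hypergraph) {e : Fin (nE H)} {x : Fin (nV H)} → e ∈ edgesAt H x → x ∈ edge H e
∈-edgesAt⁻ H {e} {x} e∈ = lookup⇒[]= x (edge H e)
  (trans (sym (lookup∘tabulate (λ e → lookup (edge H e) x) e)) ([]=⇒lookup e∈))

dual-pair-edges : (H : Hypergraph) (e f : Fin (nE H)) → edgesAt₂ (Dual H) e f ≡ edge H e ∩ edge H f
dual-pair-edges H e f = trans (tabulate-cong pointwise) (tabulate∘lookup (edge H e ∩ edge H f))
  where
  pointwise : ∀ x → lookup (edgesAt H x) e ∧ lookup (edgesAt H x) f ≡ lookup (edge H e ∩ edge H f) x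
  pointwise x = trans (cong₂ _∧_ (lookup∘tabulate (λ e → lookup (edge H e) x) e)
                                 (lookup∘tabulate (λ e → lookup (edge H e) x) f))
                      (sym (lookup-zipWith _∧_ x (edge H e) (edge H f)))

dual-design : ∀ {d t} (H : Hypergraph) → Regular d H → Pairwise t H → Design (nE H) d t (Dual H)
dual-design H reg pw = refl , reg , λ e f e≢f → trans (cong ∣_∣ (dual-pair-edges H e f)) (pw e f e≢f)

-- The parts of an r-partite hypergraph are parallel classes of its dual.
dual-resolvable : ∀ {r} (H : Hypergraph) → Partite r H → Resolvable (Dual H)
dual-resolvable {r} H (part , meets) = r , part , parallel
  where
  parallel : ∀ j e → Σ (Fin (nV H)) λ x → (part x ≡ j) × (e ∈ edgesAt H x) ×
                       (∀ y → part y ≡ j → e ∈ edgesAt H y → y ≡ x)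
  parallel j e with meets e j
  ... | x , x∈e , part-x , unique =
    x , part-x , ∈-edgesAt⁺ H x∈e , λ y part-y e∈ → unique y (∈-edgesAt⁻ H e∈) part-y

dual-dual : (H : Hypergraph) → Isomorphic H (Dual (Dual H))
dual-dual H = ↔-id _ , ↔-id _ , λ e x →
  sym (trans (lookup∘tabulate (λ y → lookup (edgesAt H y) e) x) (lookup∘tabulate (λ f → lookup (edge H f) x) e))

pairwise-of-dual-design : ∀ {v d t} (H D : Hypergraph) → Design v d t D → Isomorphic H (Dual D) → Pairwise t H
pairwise-of-dual-design H D (_ , _ , pair-degree) (σ , π , incidence) e f e≢f =
  trans (∣∣-reindex σ (edge H e ∩ edge H f) (edgesAt₂ D (π⟨ e ⟩) (π⟨ f ⟩)) relabel)
        (pair-degree π⟨ e ⟩ π⟨ f ⟩ (λ eq → e≢f (Injection.injective (Inverse⇒Injection π) eq)))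
  where
  π⟨_⟩ = Inverse.to π
  σ⟨_⟩ = Inverse.to σ
  in-dual : ∀ g x → lookup (edge H g) x ≡ lookup (edge D σ⟨ x ⟩) π⟨ g ⟩
  in-dual g x = trans (incidence g x) (lookup∘tabulate (λ b → lookup (edge D b) π⟨ g ⟩) σ⟨ x ⟩)
  relabel : ∀ x → lookup (edge H e ∩ edge H f) x ≡ lookup (edgesAt₂ D π⟨ e ⟩ π⟨ f ⟩) σ⟨ x ⟩
  relabel x = trans (lookup-zipWith _∧_ x (edge H e) (edge H f))
                (trans (cong₂ _∧_ (in-dual e x) (in-dual f x))
                       (sym (lookup∘tabulate (λ b → lookup (edge D b) π⟨ e ⟩ ∧ lookup (edge D b) π⟨ f ⟩) σ⟨ x ⟩)))

-- With m = nE H: d·t·τ + r ≤ m·t + r ≤ r·d + t, where the first step is the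
-- cover estimate d·τ ≤ m and the second the row bound at some edge e₀.
corollary3p5 : (r t d : ℕ) → 1 ≤ d → 1 ≤ t → (H : Hypergraph) → 1 ≤ nE H →
    RTGraph r t H → Regular d H → (k : ℕ) → IsTau H k →
      (d * t * k + r ≤ r * d + t)
      × ((d * t * k + r ≡ r * d + t) ⇔
         (Σ ℕ λ v → Σ Hypergraph λ D → Design v d t D × Resolvable D × Isomorphic H (Dual D)))
corollary3p5 r t d _ 1≤t H 1≤m (uni , partite , int) reg k ((C , cover , ∣C∣≡k) , minimal) =
  ≤-trans cover-step (row-bound H uni reg int e₀) , mk⇔ equality⇒design design⇒equality
  where
  e₀ : Fin (nE H)
  e₀ = fromℕ< 1≤m

  instance
    r≢0 : NonZero r
    r≢0 = >-nonZero (≤-trans 1≤t (subst (_ ≤_) (meet-diagonal H uni e₀) (int e₀ e₀)))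

  dtk≡dkt : d * t * k ≡ d * k * t
  dtk≡dkt = solve 3 (λ d t k → d :* t :* k := d :* k :* t) refl d t k
    where open +-*-Solver

  dk≤m : d * k ≤ nE H
  dk≤m = regular-partite-cover-bound H uni partite reg k minimal

  cover-step : d * t * k + r ≤ nE H * t + r
  cover-step = +-monoˡ-≤ r (≤-trans (≤-reflexive dtk≡dkt) (*-monoˡ-≤ t dk≤m))

  equality⇒design : d * t * k + r ≡ r * d + t →
    Σ ℕ λ v → Σ Hypergraph λ D → Design v d t D × Resolvable D × Isomorphic H (Dual D)
  equality⇒design eq = nE H , Dual H , dual-design H reg pairwise , dual-resolvable H partite , dual-dual H
    where
    pairwise : Pairwise t H
    pairwise = row-tight H uni reg int (≤-trans (≤-reflexive (sym eq)) cover-step)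

  design⇒equality : (Σ ℕ λ v → Σ Hypergraph λ D → Design v d t D × Resolvable D × Isomorphic H (Dual D)) →
    d * t * k + r ≡ r * d + t
  design⇒equality (_ , D , design , _ , iso) = begin
    d * t * k + r   ≡⟨ cong (_+ r) (trans dtk≡dkt (cong (_* t) dk≡m)) ⟩
    nE H * t + r    ≡⟨ row-exact H uni reg (pairwise-of-dual-design H D design iso) e₀ ⟨
    r * d + t       ∎
    where
    open ≡-Reasoning
    m≤dk : nE H ≤ d * k
    m≤dk = ≤-trans (cover-lower-bound H reg C cover) (≤-reflexive (trans (cong (_* d) ∣C∣≡k) (*-comm k d)))
    dk≡m : d * k ≡ nE H
    dk≡m = ≤-antisym dk≤m m≤dk
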